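{- Let $\Sigma$ be a finite set of states and $\mathcal{L}$ a language with atoms $\mathit{AP}$ and operators $\mathit{Op}$, interpreted on $\Sigma$ by sets $\boldsymbol{p}\subseteq\Sigma$ ($p\in\mathit{AP}$) and functions $\boldsymbol{f}:\wp(\Sigma)^{n_f}\to\wp(\Sigma)$ ($f\in\mathit{Op}$, $n_f>0$). Suppose $\mathcal{L}$ is closed under conjunction and negation. Then every run of the algorithm $\mathrm{GPT}^{\mathrm{Part}}_{\boldsymbol{Op}_\mathcal{L}}$ on input $P_\ell$ terminates and outputs $P_\mathcal{L}$.
   Context: Formulas: $\varphi::=p\mid f(\varphi_1,\dots,\varphi_{n_f})$; semantics $[\![p]\!]=\boldsymbol{p}$, $[\![f(\varphi_1,\dots,\varphi_n)]\!]=\boldsymbol{f}([\![\varphi_1]\!],\dots,[\![\varphi_n]\!])$. $\boldsymbol{Op}_\mathcal{L}=\{\boldsymbol{f}\mid f\in\mathit{Op}\}$. $\mathcal{L}$ is closed under conjunction if for every finite $\Phi\subseteq\mathcal{L}$ (including $\Phi=\varnothing$, giving $\Sigma$) there is $\psi\in\mathcal{L}$ with $\bigcap_{\varphi\in\Phi}[\![\varphi]\!]=[\![\psi]\!]$; closed under negation if for every $\varphi$ there is $\psi$ with $[\![\psi]\!]=\Sigma\smallsetminus[\![\varphi]\!]$. $P_\mathcal{L}$ is the partition of $\Sigma$ where $s,s'$ share a block iff for all $\varphi\in\mathcal{L}$, $s\in[\![\varphi]\!]\iff s'\in[\![\varphi]\!]$. $P_\ell$ is the partition where $s,s'$ share a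 block iff for all $p\in\mathit{AP}$, $s\in\boldsymbol{p}\iff s'\in\boldsymbol{p}$. Partitions: $P_1\preceq P_2$ iff each block of $P_1$ lies in a block of $P_2$, $\prec$ strict; $P\curlywedge Q=\{B\cap C\neq\varnothing\mid B\in P,C\in Q\}$; $\mathrm{pad}(P)=\{\bigcup Q\mid Q\subseteq P\}$. For a set $F$ of functions, $F^{ -\complement}$ is $F$ without the complement operator. Algorithm $\mathrm{GPT}^{\mathrm{Part}}_F$ on input partition $P$: while there exist $f\in F^{ -\complement}$ and $\vec S\in\mathrm{pad}(P)^{n_f}$ with $P\curlywedge\{f(\vec S),\Sigma\smallsetminus f(\vec S)\}\prec P$, choose such $f,\vec S$ and set $P:=P\curlywedge\{f(\vec S),\Sigma\smallsetminus f(\vec S)\}$ (with empty sets discarded); output $P$. -}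

module Defs where

open import Data.Nat using (ℕ; _<_)
open import Data.Bool using (Bool)
open import Data.Fin using (Fin)
open import Data.Fin.Subset using (Subset; _∈_; _∩_; ∁; ⋃; ⋂; _⊆_; Nonempty)
open import Data.Fin.Subset.Properties using (nonempty?)
open import Data.Vec using (Vec; []; _∷_)
open import Data.Vec.Relation.Unary.All as VAll using ()
open import Data.List using (List; []; _∷_; map; concatMap; filter)
open import Data.List.Relation.Unary.All using (All)
open import Data.List.Membership.Propositional renaming (_∈_ to _∈ₗ_)
open import Data.Product using (Σ; ∃; _×_; _,_)
open import Function.Bundles using (_⇔_)
open import Relation.Nullary using (¬_)
open import Relation.Binary.PropositionalEquality using (_≡_; subst; sym)
open import Relation.Binary.Construct.Closure.ReflexiveTransitive using (Star)
open import Induction.WellFounded using (Acc)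

record Lang : Set₁ where
  field
    size    : ℕ
    AP      : Set
    Op      : Set
    arity   : Op → ℕ
    arity>0 : ∀ f → 0 < arity f
    atomI   : AP → Subset size
    opI     : (f : Op) → Vec (Subset size) (arity f) → Subset size

module _ (L : Lang) where
  open Lang L

  St : Set
  St = Fin size

  data Formula : Set where
    atom : AP → Formula
    app  : (f : Op) → Vec Formula (arity f) → Formula

  mutual
    ⟦_⟧ : Formula → Subset size
    ⟦ atom p ⟧ = atomI p
    ⟦ app f φs ⟧ = opI f (⟦_⟧s φs)

    ⟦_⟧s : ∀ {k} → Vec Formula k → Vec (Subset size) k
    ⟦ [] ⟧s = []
    ⟦ φ ∷ φs ⟧s = ⟦ φ ⟧ ∷ ⟦ φs ⟧s

  -- closure under conjunction (finite Φ, including Φ = [] giving Σ)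
  ClosedConj : Set
  ClosedConj = (Φ : List Formula) → ∃ λ ψ → ⋂ (map ⟦_⟧ Φ) ≡ ⟦ ψ ⟧

  ClosedNeg : Set
  ClosedNeg = (φ : Formula) → ∃ λ ψ → ⟦ ψ ⟧ ≡ ∁ ⟦ φ ⟧

  -- Partitions are represented as finite lists of blocks (read as sets of blocks).
  Partition : Set
  Partition = List (Subset size)

  _≐_ : Partition → Partition → Set
  P ≐ Q = ∀ B → (B ∈ₗ P) ⇔ (B ∈ₗ Q)

  _⪯_ : Partition → Partition → Set
  P₁ ⪯ P₂ = ∀ B → B ∈ₗ P₁ → ∃ λ C → C ∈ₗ P₂ × B ⊆ C

  _≺_ : Partition → Partition → Set
  P₁ ≺ P₂ = P₁ ⪯ P₂ × ¬ (P₁ ≐ P₂)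

  _⋏_ : Partition → Partition → Partition
  P ⋏ Q = filter nonempty? (concatMap (λ B → map (B ∩_) Q) P)

  InPad : Partition → Subset size → Set
  InPad P S = ∃ λ (Q : List (Subset size)) → All (_∈ₗ P) Q × S ≡ ⋃ Q

  IsComplement : Op → Set
  IsComplement f = Σ (arity f ≡ 1) λ e →
    ∀ S → opI f (subst (Vec (Subset size)) (sym e) (S ∷ [])) ≡ ∁ S

  Step : Partition → Partition → Set
  Step P P' = Σ Op λ f → ¬ IsComplement f × Σ (Vec (Subset size) (arity f)) λ Ss →
    VAll.All (InPad P) Ss ×
    (P ⋏ (opI f Ss ∷ ∁ (opI f Ss) ∷ [])) ≺ P ×
    P' ≡ P ⋏ (opI f Ss ∷ ∁ (opI f Ss) ∷ [])

  AllRunsTerminate : Partition → Set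
  AllRunsTerminate P = Acc (λ P' P₀ → Step P₀ P') P

  Reachable : Partition → Partition → Set
  Reachable = Star Step

  Final : Partition → Set
  Final P = ¬ (∃ λ P' → Step P P')

  IsBlockℓ : Subset size → Set
  IsBlockℓ B = ∃ λ (s : St) → ∀ t → (t ∈ B) ⇔ (∀ p → (s ∈ atomI p) ⇔ (t ∈ atomI p))

  IsBlockL : Subset size → Set
  IsBlockL B = ∃ λ (s : St) → ∀ t → (t ∈ B) ⇔ (∀ φ → (s ∈ ⟦ φ ⟧) ⇔ (t ∈ ⟦ φ ⟧))

  IsPℓ : Partition → Set
  IsPℓ P = ∀ B → (B ∈ₗ P) ⇔ IsBlockℓ B

  IsPL : Partition → Set
  IsPL P = ∀ B → (B ∈ₗ P) ⇔ IsBlockL B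

{-# OPTIONS --safe #-}
-- Termination: a step strictly refines a partition of the finite set Σ, so the set of pairs
-- (s , t) lying in a common block shrinks strictly.
--
-- Correctness: along a run every block stays a union of L-classes. This holds for P_ℓ, and
-- it is preserved because every splitter f(S⃗) is itself a union of L-classes: since L is
-- closed under ∧ and ¬ and Σ is finite, each union of L-classes S is ⟦ψ⟧ for some ψ, so
-- f(S⃗) = ⟦f(ψ⃗)⟧. Conversely, when no step applies, every ⟦φ⟧ is a union of blocks, by
-- induction on φ: otherwise ⟦f(φ⃗)⟧ = f(⟦φ⃗⟧), with arguments in pad(P), would split P
-- further (the excluded complement operator preserves unions of blocks anyway). Hence the
-- blocks are exactly the L-classes. Constructively only ¬ ¬ (∃ ψ) is obtained, which
-- suffices because membership in a finite subset is decidable.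
module Submission where

open import Defs hiding (⟦_⟧; _≐_; _⪯_; _≺_; _⋏_)
import Defs as D
open import Data.Empty using (⊥-elim)
open import Data.Nat using (ℕ; zero; suc; _*_)
open import Data.Fin using (Fin; zero; suc; combine; remQuot)
open import Data.Fin.Properties using (remQuot-combine)
open import Data.Fin.Subset using (Subset; _∈_; _∉_; _∩_; ∁; ⋃; _⊆_; _⊂_; Nonempty; ⊤)
open import Data.Fin.Subset.Properties using (_∈?_; _⊆?_; _⊂?_; ⊆-antisym; nonempty?; x∈p∩q⁺; x∈p∩q⁻; x∈p∪q⁺; x∈p∪q⁻; ∈⊤; ∉⊥; x∈∁p⇒x∉p; x∉p⇒x∈∁p)
open import Data.Fin.Subset.Induction using (⊂-wellFounded)
open import Data.Vec using (Vec; []; _∷_; tabulate; lookup)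
open import Data.Vec.Properties using (lookup∘tabulate; []=⇒lookup; lookup⇒[]=)
open import Data.Vec.Relation.Unary.All as VAll using ([]; _∷_)
open import Data.List using (List; []; _∷_; filter; map; concatMap)
open import Data.List.Relation.Unary.All as LAll using ()
open import Data.List.Relation.Unary.Any using (Any; here; there; any?)
open import Data.List.Membership.Propositional using (find; lose) renaming (_∈_ to _∈ₗ_)
open import Data.List.Membership.Propositional.Properties using (∈-filter⁺; ∈-filter⁻; ∈-concatMap⁺; ∈-concatMap⁻; ∈-map⁺; ∈-map⁻)
open import Data.Product using (_×_; _,_; ∃; ∃₂; proj₁; proj₂; uncurry)
open import Data.Sum using (_⊎_; inj₁; inj₂)
open import Function using (_∘_)
open import Function.Bundles using (_⇔_; mk⇔; Equivalence)
import Function.Properties.Equivalence as ⇔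
open import Relation.Nullary using (¬_; Dec; yes; no; does)
open import Relation.Nullary.Decidable using (decidable-stable; dec-true; ¬¬-excluded-middle; _×-dec_)
open import Relation.Nullary.Negation using (¬¬-map)
open import Relation.Unary using (Decidable)
open import Relation.Binary using (IsEquivalence)
open import Relation.Binary.PropositionalEquality using (_≡_; refl; sym; trans; cong₂; subst)
open import Relation.Binary.Construct.Closure.ReflexiveTransitive using (ε; _◅_)
open import Induction.WellFounded using (Acc; acc)

open Equivalence using (to; from)

¬¬-∀-Fin : ∀ {n} {P : Fin n → Set} → (∀ i → ¬ ¬ P i) → ¬ ¬ (∀ i → P i)
¬¬-∀-Fin {zero}  _ k = k λ ()
¬¬-∀-Fin {suc n} h k = h zero λ p₀ → ¬¬-∀-Fin (h ∘ suc) λ ps → k λ { zero → p₀ ; (suc i) → ps i }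

All-singleton : ∀ {A : Set} {Pr : A → Set} {k} (k≡1 : k ≡ 1) {v : Vec A k} → VAll.All Pr v →
                ∃ λ a → Pr a × v ≡ subst (Vec A) (sym k≡1) (a ∷ [])
All-singleton refl (pa ∷ []) = _ , pa , refl

module _ {n : ℕ} where

  ∈-ext : {X Y : Subset n} → (∀ i → i ∈ X ⇔ i ∈ Y) → X ≡ Y
  ∈-ext h = ⊆-antisym (to (h _)) (from (h _))

  toSubset : {P : Fin n → Set} → Decidable P → Subset n
  toSubset P? = tabulate (does ∘ P?)

  ∈-toSubset : {P : Fin n → Set} (P? : Decidable P) {i : Fin n} → i ∈ toSubset P? ⇔ P i
  ∈-toSubset {P} P? {i} = mk⇔ in⇒P P⇒in
    where
      lookup-toSubset : lookup (toSubset P?) i ≡ does (P? i)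
      lookup-toSubset = lookup∘tabulate (does ∘ P?) i
      in⇒P : i ∈ toSubset P? → P i
      in⇒P i∈ with P? i | trans (sym lookup-toSubset) ([]=⇒lookup i∈)
      ... | yes Pi | _  = Pi
      ... | no _   | ()
      P⇒in : P i → i ∈ toSubset P?
      P⇒in Pi = lookup⇒[]= i _ (trans lookup-toSubset (dec-true (P? i) Pi))

  ∈-⋃⁺ : {Xs : List (Subset n)} {i : Fin n} → Any (i ∈_) Xs → i ∈ ⋃ Xs
  ∈-⋃⁺ (here i∈X)   = x∈p∪q⁺ (inj₁ i∈X)
  ∈-⋃⁺ (there i∈Xs) = x∈p∪q⁺ (inj₂ (∈-⋃⁺ i∈Xs))

  ∈-⋃⁻ : (Xs : List (Subset n)) {i : Fin n} → i ∈ ⋃ Xs → Any (i ∈_) Xs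
  ∈-⋃⁻ []       i∈ = ⊥-elim (∉⊥ i∈)
  ∈-⋃⁻ (X ∷ Xs) i∈ with x∈p∪q⁻ X (⋃ Xs) i∈
  ... | inj₁ i∈X  = here i∈X
  ... | inj₂ i∈Xs = there (∈-⋃⁻ Xs i∈Xs)

module _ (L : Lang) where
  open Lang L

  infix 4 _≐_ _⪯_ _≺_
  infixl 7 _⋏_

  ⟦_⟧ : Formula L → Subset size
  ⟦_⟧ = D.⟦_⟧ L

  _≐_ _⪯_ _≺_ : Partition L → Partition L → Set
  _≐_ = D._≐_ L
  _⪯_ = D._⪯_ L
  _≺_ = D._≺_ L

  _⋏_ : Partition L → Partition L → Partition L
  _⋏_ = D._⋏_ L

  private
    variable
      P Q P′ : Partition L
      A B C X Y : Subset size
      s t : St L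
      φ ψ : Formula L

  Disjoint : Partition L → Set
  Disjoint P = ∀ {B C s} → B ∈ₗ P → C ∈ₗ P → s ∈ B → s ∈ C → B ≡ C

  Covers : Partition L → Set
  Covers P = ∀ s → ∃ λ B → B ∈ₗ P × s ∈ B

  record IsPartition (P : Partition L) : Set where
    field
      nonempty : ∀ {B} → B ∈ₗ P → Nonempty B
      disjoint : Disjoint P
      covers   : Covers P

  open IsPartition

  split : Subset size → Partition L
  split A = A ∷ ∁ A ∷ []

  split-disjoint : Disjoint (split A)
  split-disjoint (here refl)         (here refl)         _    _    = refl
  split-disjoint (here refl)         (there (here refl)) s∈A  s∈∁A = ⊥-elim (x∈∁p⇒x∉p s∈∁A s∈A)
  split-disjoint (there (here refl)) (here refl)         s∈∁A s∈A  = ⊥-elim (x∈∁p⇒x∉p s∈∁A s∈A)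
  split-disjoint (there (here refl)) (there (here refl)) _    _    = refl

  split-covers : Covers (split A)
  split-covers {A} s with s ∈? A
  ... | yes s∈A = A , here refl , s∈A
  ... | no  s∉A = ∁ A , there (here refl) , x∉p⇒x∈∁p s∉A

  ∈-⋏⁻ : X ∈ₗ P ⋏ Q → Nonempty X × ∃₂ λ B C → B ∈ₗ P × C ∈ₗ Q × X ≡ B ∩ C
  ∈-⋏⁻ {P = P} {Q} X∈ with ∈-filter⁻ nonempty? {xs = concatMap (λ B → map (B ∩_) Q) P} X∈
  ... | X∈′ , X≠∅ with find (∈-concatMap⁻ (λ B → map (B ∩_) Q) {xs = P} X∈′)
  ... | B , B∈P , X∈B∩Q with ∈-map⁻ (B ∩_) X∈B∩Q
  ... | C , C∈Q , X≡B∩C = X≠∅ , B , C , B∈P , C∈Q , X≡B∩C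

  ∈-⋏⁺ : B ∈ₗ P → C ∈ₗ Q → Nonempty (B ∩ C) → B ∩ C ∈ₗ P ⋏ Q
  ∈-⋏⁺ {B} {Q = Q} B∈P C∈Q B∩C≠∅ =
    ∈-filter⁺ nonempty? (∈-concatMap⁺ (λ B → map (B ∩_) Q) (lose B∈P (∈-map⁺ (B ∩_) C∈Q))) B∩C≠∅

  ⋏-⪯ˡ : P ⋏ Q ⪯ P
  ⋏-⪯ˡ _ X∈ with ∈-⋏⁻ X∈
  ... | _ , B , C , B∈P , _ , refl = B , B∈P , proj₁ ∘ x∈p∩q⁻ B C

  ⋏-disjoint : Disjoint P → Disjoint Q → Disjoint (P ⋏ Q)
  ⋏-disjoint dP dQ X∈ Y∈ s∈X s∈Y with ∈-⋏⁻ X∈ | ∈-⋏⁻ Y∈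
  ... | _ , B , C , B∈ , C∈ , refl | _ , B′ , C′ , B′∈ , C′∈ , refl =
    let s∈B , s∈C = x∈p∩q⁻ B C s∈X ; s∈B′ , s∈C′ = x∈p∩q⁻ B′ C′ s∈Y in
    cong₂ _∩_ (dP B∈ B′∈ s∈B s∈B′) (dQ C∈ C′∈ s∈C s∈C′)

  ⋏-covers : Covers P → Covers Q → Covers (P ⋏ Q)
  ⋏-covers cP cQ s with cP s | cQ s
  ... | B , B∈ , s∈B | C , C∈ , s∈C =
    let s∈B∩C = x∈p∩q⁺ (s∈B , s∈C) in B ∩ C , ∈-⋏⁺ B∈ C∈ (s , s∈B∩C) , s∈B∩C

  ⋏-isPartition : IsPartition P → Disjoint Q → Covers Q → IsPartition (P ⋏ Q)
  ⋏-isPartition {P} {Q} πP dQ cQ = record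
    { nonempty = λ X∈ → proj₁ (∈-⋏⁻ {P = P} {Q} X∈)
    ; disjoint = ⋏-disjoint (disjoint πP) dQ
    ; covers   = ⋏-covers (covers πP) cQ
    }

  -- Termination

  SameBlock : Partition L → St L → St L → Set
  SameBlock P s t = Any (λ B → s ∈ B × t ∈ B) P

  sameBlock? : ∀ P s t → Dec (SameBlock P s t)
  sameBlock? P s t = any? (λ B → s ∈? B ×-dec t ∈? B) P

  ⪯-sameBlock : P ⪯ Q → SameBlock P s t → SameBlock Q s t
  ⪯-sameBlock P⪯Q st with find st
  ... | B , B∈P , s∈B , t∈B with P⪯Q B B∈P
  ... | C , C∈Q , B⊆C = lose C∈Q (B⊆C s∈B , B⊆C t∈B)

  ∈-block⇔sameBlock : Disjoint P → B ∈ₗ P → s ∈ B → t ∈ B ⇔ SameBlock P s t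
  ∈-block⇔sameBlock {B = B} d B∈P s∈B = mk⇔ (λ t∈B → lose B∈P (s∈B , t∈B)) λ st →
    let C , C∈P , s∈C , t∈C = find st in subst (_ ∈_) (d C∈P B∈P s∈C s∈B) t∈C

  sameBlock⇔⇒⊆ : IsPartition P → IsPartition Q → (∀ s t → SameBlock P s t ⇔ SameBlock Q s t) →
                 B ∈ₗ P → B ∈ₗ Q
  sameBlock⇔⇒⊆ {Q = Q} {B} πP πQ same B∈P with nonempty πP B∈P
  ... | s , s∈B with covers πQ s
  ... | C , C∈Q , s∈C = subst (_∈ₗ Q) (∈-ext C⇔B) C∈Q
    where
      C⇔B : ∀ t → t ∈ C ⇔ t ∈ B
      C⇔B t = ⇔.trans (∈-block⇔sameBlock (disjoint πQ) C∈Q s∈C)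
                (⇔.trans (⇔.sym (same s t)) (⇔.sym (∈-block⇔sameBlock (disjoint πP) B∈P s∈B)))

  sameBlock⇔⇒≐ : IsPartition P → IsPartition Q → (∀ s t → SameBlock P s t ⇔ SameBlock Q s t) →
                 P ≐ Q
  sameBlock⇔⇒≐ πP πQ same _ =
    mk⇔ (sameBlock⇔⇒⊆ πP πQ same) (sameBlock⇔⇒⊆ πQ πP λ s t → ⇔.sym (same s t))

  sameBlockGraph : Partition L → Subset (size * size)
  sameBlockGraph P = toSubset λ k → uncurry (sameBlock? P) (remQuot size k)

  ∈-sameBlockGraph : ∀ {k} → k ∈ sameBlockGraph P ⇔ uncurry (SameBlock P) (remQuot size k)
  ∈-sameBlockGraph {P} = ∈-toSubset λ k → uncurry (sameBlock? P) (remQuot size k)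

  combine∈sameBlockGraph : combine s t ∈ sameBlockGraph P ⇔ SameBlock P s t
  combine∈sameBlockGraph {s} {t} {P} =
    subst (λ st → combine s t ∈ sameBlockGraph P ⇔ uncurry (SameBlock P) st)
          (remQuot-combine s t) ∈-sameBlockGraph

  ≺⇒sameBlockGraph-⊂ : IsPartition P → IsPartition Q → P ≺ Q → sameBlockGraph P ⊂ sameBlockGraph Q
  ≺⇒sameBlockGraph-⊂ {P} {Q} πP πQ (P⪯Q , P≉Q) =
    decidable-stable (sameBlockGraph P ⊂? sameBlockGraph Q) λ ¬⊂ →
      P≉Q (sameBlock⇔⇒≐ πP πQ λ s t → mk⇔ (⪯-sameBlock P⪯Q) (reflect ¬⊂))
    where
      graph-⊆ : sameBlockGraph P ⊆ sameBlockGraph Q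
      graph-⊆ = from ∈-sameBlockGraph ∘ ⪯-sameBlock P⪯Q ∘ to ∈-sameBlockGraph
      reflect : ¬ sameBlockGraph P ⊂ sameBlockGraph Q → SameBlock Q s t → SameBlock P s t
      reflect {s} {t} ¬⊂ st = to combine∈sameBlockGraph
        (decidable-stable (combine s t ∈? sameBlockGraph P) λ ∉ →
          ¬⊂ (graph-⊆ , combine s t , from combine∈sameBlockGraph st , ∉))

  step-isPartition : IsPartition P → Step L P P′ → IsPartition P′
  step-isPartition πP (_ , _ , _ , _ , _ , refl) = ⋏-isPartition πP split-disjoint split-covers

  step-⊂ : IsPartition P → Step L P P′ → sameBlockGraph P′ ⊂ sameBlockGraph P
  step-⊂ πP step@(_ , _ , _ , _ , P′≺P , refl) =
    ≺⇒sameBlockGraph-⊂ (step-isPartition πP step) πP P′≺P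

  runs-terminate : IsPartition P → AllRunsTerminate L P
  runs-terminate {P} = go (⊂-wellFounded (sameBlockGraph P))
    where
      go : ∀ {P} → Acc _⊂_ (sameBlockGraph P) → IsPartition P → AllRunsTerminate L P
      go (acc rs) πP = acc λ step → go (rs (step-⊂ πP step)) (step-isPartition πP step)

  -- Partitions into equivalence classes

  IsClassOf : (St L → St L → Set) → Subset size → Set
  IsClassOf R B = ∃ λ s → ∀ t → t ∈ B ⇔ R s t

  module _ {R : St L → St L → Set} where

    class-∈⇔ : IsEquivalence R → (∀ B → B ∈ₗ P ⇔ IsClassOf R B) →
               B ∈ₗ P → s ∈ B → ∀ t → t ∈ B ⇔ R s t
    class-∈⇔ R-equiv classes B∈P s∈B t with to (classes _) B∈P
    ... | r , r-class = mk⇔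
      (λ t∈B → R-trans (R-sym (to (r-class _) s∈B)) (to (r-class t) t∈B))
      (λ Rst → from (r-class t) (R-trans (to (r-class _) s∈B) Rst))
      where open IsEquivalence R-equiv using () renaming (sym to R-sym; trans to R-trans)

    -- Covering needs the class of s as a Subset, i.e. R s decidable; that is available under
    -- ¬ ¬, which suffices because membership of s in some block of P is decidable.
    classes⇒isPartition : IsEquivalence R → (∀ B → B ∈ₗ P ⇔ IsClassOf R B) → IsPartition P
    classes⇒isPartition {P} R-equiv classes = record
      { nonempty = λ B∈P → let r , r-class = to (classes _) B∈P in r , from (r-class r) R-refl
      ; disjoint = λ B∈P C∈P s∈B s∈C → ∈-ext λ t →
          ⇔.trans (class-∈⇔ R-equiv classes B∈P s∈B t) (⇔.sym (class-∈⇔ R-equiv classes C∈P s∈C t))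
      ; covers   = λ s → find (decidable-stable (any? (s ∈?_) P) λ s∉⋃P →
          ¬¬-∀-Fin (λ _ → ¬¬-excluded-middle) λ R? →
            s∉⋃P (lose (from (classes _) (s , λ _ → ∈-toSubset R?)) (from (∈-toSubset R?) R-refl)))
      }
      where open IsEquivalence R-equiv using () renaming (refl to R-refl)

    isPartition⇒classes : IsPartition P → (∀ {B s} → B ∈ₗ P → s ∈ B → ∀ t → t ∈ B ⇔ R s t) →
                          ∀ B → B ∈ₗ P ⇔ IsClassOf R B
    isPartition⇒classes {P} πP blocks B = mk⇔
      (λ B∈P → let s , s∈B = nonempty πP B∈P in s , blocks B∈P s∈B)
      (λ (r , r-class) → let C , C∈P , r∈C = covers πP r in
        subst (_∈ₗ P) (∈-ext λ t → ⇔.trans (blocks C∈P r∈C t) (⇔.sym (r-class t))) C∈P)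

  -- IsBlockℓ and IsBlockL are IsClassOf _≈ℓ_ and IsClassOf _≈ᴸ_, definitionally.
  _≈ℓ_ : St L → St L → Set
  s ≈ℓ t = ∀ p → s ∈ atomI p ⇔ t ∈ atomI p

  _≈ᴸ_ : St L → St L → Set
  s ≈ᴸ t = ∀ φ → s ∈ ⟦ φ ⟧ ⇔ t ∈ ⟦ φ ⟧

  ≈ℓ-isEquivalence : IsEquivalence _≈ℓ_
  ≈ℓ-isEquivalence = record
    { refl  = λ _ → ⇔.refl
    ; sym   = λ s≈t p → ⇔.sym (s≈t p)
    ; trans = λ r≈s s≈t p → ⇔.trans (r≈s p) (s≈t p)
    }

  ≈ᴸ-sym : s ≈ᴸ t → t ≈ᴸ s
  ≈ᴸ-sym s≈t φ = ⇔.sym (s≈t φ)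

  ≈ᴸ⇒≈ℓ : s ≈ᴸ t → s ≈ℓ t
  ≈ᴸ⇒≈ℓ s≈t p = s≈t (atom p)

  -- Unions of L-classes and unions of blocks

  Saturated : Subset size → Set
  Saturated X = ∀ {s t} → s ≈ᴸ t → s ∈ X → t ∈ X

  BlockClosed : Partition L → Subset size → Set
  BlockClosed P X = ∀ {B s t} → B ∈ₗ P → s ∈ B → t ∈ B → s ∈ X → t ∈ X

  ∁-saturated : Saturated X → Saturated (∁ X)
  ∁-saturated X-sat s≈t s∈∁X = x∉p⇒x∈∁p λ t∈X → x∈∁p⇒x∉p s∈∁X (X-sat (≈ᴸ-sym s≈t) t∈X)

  ∩-saturated : Saturated X → Saturated Y → Saturated (X ∩ Y)
  ∩-saturated X-sat Y-sat s≈t s∈X∩Y =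
    let s∈X , s∈Y = x∈p∩q⁻ _ _ s∈X∩Y in x∈p∩q⁺ (X-sat s≈t s∈X , Y-sat s≈t s∈Y)

  inPad-saturated : (∀ {B} → B ∈ₗ P → Saturated B) → InPad L P X → Saturated X
  inPad-saturated blocks-sat (Bs , Bs⊆P , refl) s≈t s∈⋃Bs =
    let B , B∈Bs , s∈B = find (∈-⋃⁻ Bs s∈⋃Bs) in
    ∈-⋃⁺ (lose B∈Bs (blocks-sat (LAll.lookup Bs⊆P B∈Bs) s≈t s∈B))

  ⋏-saturated : (∀ {B} → B ∈ₗ P → Saturated B) → (∀ {C} → C ∈ₗ Q → Saturated C) →
                ∀ {X} → X ∈ₗ P ⋏ Q → Saturated X
  ⋏-saturated P-sat Q-sat X∈ with ∈-⋏⁻ X∈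
  ... | _ , _ , _ , B∈P , C∈Q , refl = ∩-saturated (P-sat B∈P) (Q-sat C∈Q)

  split-saturated : Saturated A → ∀ {C} → C ∈ₗ split A → Saturated C
  split-saturated A-sat (here refl)         = A-sat
  split-saturated A-sat (there (here refl)) = ∁-saturated A-sat

  ∁-blockClosed : BlockClosed P X → BlockClosed P (∁ X)
  ∁-blockClosed X-cl B∈P s∈B t∈B s∈∁X = x∉p⇒x∈∁p λ t∈X → x∈∁p⇒x∉p s∈∁X (X-cl B∈P t∈B s∈B t∈X)

  ⪯-blockClosed : P ⪯ Q → BlockClosed Q X → BlockClosed P X
  ⪯-blockClosed P⪯Q X-cl B∈P s∈B t∈B with P⪯Q _ B∈P
  ... | C , C∈Q , B⊆C = X-cl C∈Q (B⊆C s∈B) (B⊆C t∈B)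

  blockClosed⇒inPad : Covers P → BlockClosed P X → InPad L P X
  blockClosed⇒inPad {P} {X} cov X-cl =
    filter (_⊆? X) P , LAll.tabulate (proj₁ ∘ ∈-filter⁻ (_⊆? X) {xs = P}) ,
    ∈-ext λ s → mk⇔ (⊆-⋃ s) (⋃-⊆ s)
    where
      ⊆-⋃ : ∀ s → s ∈ X → s ∈ ⋃ (filter (_⊆? X) P)
      ⊆-⋃ s s∈X = let B , B∈P , s∈B = cov s in
        ∈-⋃⁺ (lose (∈-filter⁺ (_⊆? X) B∈P λ t∈B → X-cl B∈P s∈B t∈B s∈X) s∈B)
      ⋃-⊆ : ∀ s → s ∈ ⋃ (filter (_⊆? X) P) → s ∈ X
      ⋃-⊆ s s∈⋃ = let B , B∈ , s∈B = find (∈-⋃⁻ _ s∈⋃) in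
        proj₂ (∈-filter⁻ (_⊆? X) {xs = P} B∈) s∈B

  ⋏-split-≐⇒blockClosed : Disjoint P → P ⋏ split A ≐ P → BlockClosed P A
  ⋏-split-≐⇒blockClosed {P} {A} d P⋏A≐P {B} {s} {t} B∈P s∈B t∈B s∈A =
    proj₂ (x∈p∩q⁻ B A (subst (t ∈_) (sym B∩A≡B) t∈B))
    where
      s∈B∩A : s ∈ B ∩ A
      s∈B∩A = x∈p∩q⁺ (s∈B , s∈A)
      B∩A≡B : B ∩ A ≡ B
      B∩A≡B = d (to (P⋏A≐P _) (∈-⋏⁺ B∈P (here refl) (s , s∈B∩A))) B∈P s∈B∩A s∈B

  -- Invariant of runs, and final partitions

  record Invariant (P : Partition L) : Set where
    field
      isPartition      : IsPartition P
      atoms-closed     : ∀ p → BlockClosed P (atomI p)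
      blocks-saturated : ∀ {B} → B ∈ₗ P → Saturated B

  Pℓ-invariant : IsPℓ L P → Invariant P
  Pℓ-invariant {P} isPℓ = record
    { isPartition      = classes⇒isPartition ≈ℓ-isEquivalence isPℓ
    ; atoms-closed     = λ p B∈P s∈B t∈B → to (to (block⇔≈ℓ B∈P s∈B _) t∈B p)
    ; blocks-saturated = λ B∈P s≈t s∈B → from (block⇔≈ℓ B∈P s∈B _) (≈ᴸ⇒≈ℓ s≈t)
    }
    where
      block⇔≈ℓ : ∀ {B s} → B ∈ₗ P → s ∈ B → ∀ t → t ∈ B ⇔ s ≈ℓ t
      block⇔≈ℓ = class-∈⇔ ≈ℓ-isEquivalence isPℓ

  complement-blockClosed : ∀ {f Ss} → IsComplement L f → VAll.All (BlockClosed P) Ss →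
                           BlockClosed P (opI f Ss)
  complement-blockClosed {P} (arity≡1 , f≗∁) Ss-cl with All-singleton arity≡1 Ss-cl
  ... | S , S-cl , refl = subst (BlockClosed P) (sym (f≗∁ S)) (∁-blockClosed S-cl)

  -- A splitter that is not block-closed would refine P strictly, i.e. allow a further step.
  final-op-blockClosed : Final L P → IsPartition P → ∀ f {Ss} → VAll.All (BlockClosed P) Ss →
                         BlockClosed P (opI f Ss)
  final-op-blockClosed final πP f {Ss} Ss-cl B∈P s∈B t∈B s∈A =
    decidable-stable (_ ∈? opI f Ss) λ t∉A → final
      ( _ , f , (λ f-∁ → t∉A (complement-blockClosed f-∁ Ss-cl B∈P s∈B t∈B s∈A))
      , Ss , VAll.map (blockClosed⇒inPad (covers πP)) Ss-cl
      , (⋏-⪯ˡ , λ P⋏A≐P → t∉A (⋏-split-≐⇒blockClosed (disjoint πP) P⋏A≐P B∈P s∈B t∈B s∈A))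
      , refl )

  module _ {P : Partition L} (final : Final L P) (inv : Invariant P) where
    open Invariant inv

    mutual
      ⟦⟧-blockClosed : ∀ φ → BlockClosed P ⟦ φ ⟧
      ⟦⟧-blockClosed (atom p)   = atoms-closed p
      ⟦⟧-blockClosed (app f φs) = final-op-blockClosed final isPartition f (⟦⟧s-blockClosed φs)

      ⟦⟧s-blockClosed : ∀ {k} (φs : Vec (Formula L) k) → VAll.All (BlockClosed P) (⟦_⟧s L φs)
      ⟦⟧s-blockClosed []       = []
      ⟦⟧s-blockClosed (φ ∷ φs) = ⟦⟧-blockClosed φ ∷ ⟦⟧s-blockClosed φs

    final-isPL : IsPL L P
    final-isPL = isPartition⇒classes isPartition λ B∈P s∈B t → mk⇔
      (λ t∈B φ → mk⇔ (⟦⟧-blockClosed φ B∈P s∈B t∈B) (⟦⟧-blockClosed φ B∈P t∈B s∈B))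
      (λ s≈t → blocks-saturated B∈P s≈t s∈B)

  -- Definability of unions of L-classes

  Definable : (St L → Set) → Set
  Definable Q = ∃ λ ψ → ∀ s → s ∈ ⟦ ψ ⟧ ⇔ Q s

  definable-cong : {Q R : St L → Set} → (∀ s → Q s ⇔ R s) → Definable Q → Definable R
  definable-cong Q⇔R (ψ , ψ⇔Q) = ψ , λ s → ⇔.trans (ψ⇔Q s) (Q⇔R s)

  Separable : St L → St L → Set
  Separable s t = ∃ λ φ → s ∈ ⟦ φ ⟧ × t ∉ ⟦ φ ⟧

  module _ (conj-closed : ClosedConj L) (neg-closed : ClosedNeg L) where

    top : Formula L
    top = proj₁ (conj-closed [])

    ∈-top : s ∈ ⟦ top ⟧
    ∈-top {s} = subst (s ∈_) (proj₂ (conj-closed [])) ∈⊤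

    conj : Formula L → Formula L → Formula L
    conj φ ψ = proj₁ (conj-closed (φ ∷ ψ ∷ []))

    ∈-conj : s ∈ ⟦ conj φ ψ ⟧ ⇔ (s ∈ ⟦ φ ⟧ × s ∈ ⟦ ψ ⟧)
    ∈-conj {s} {φ} {ψ} = mk⇔
      (λ s∈ → let s∈φ , s∈ψ∩⊤ = x∈p∩q⁻ _ _ (subst (s ∈_) (sym ⋂≡) s∈) in
        s∈φ , proj₁ (x∈p∩q⁻ _ _ s∈ψ∩⊤))
      (λ (s∈φ , s∈ψ) → subst (s ∈_) ⋂≡ (x∈p∩q⁺ (s∈φ , x∈p∩q⁺ (s∈ψ , ∈⊤))))
      where
        ⋂≡ : ⟦ φ ⟧ ∩ (⟦ ψ ⟧ ∩ ⊤) ≡ ⟦ conj φ ψ ⟧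
        ⋂≡ = proj₂ (conj-closed (φ ∷ ψ ∷ []))

    neg : Formula L → Formula L
    neg φ = proj₁ (neg-closed φ)

    ∈-neg : s ∈ ⟦ neg φ ⟧ ⇔ s ∉ ⟦ φ ⟧
    ∈-neg {s} {φ} = mk⇔
      (x∈∁p⇒x∉p ∘ subst (s ∈_) (proj₂ (neg-closed φ)))
      (subst (s ∈_) (sym (proj₂ (neg-closed φ))) ∘ x∉p⇒x∈∁p)

    definable-× : {Q R : St L → Set} → Definable Q → Definable R → Definable (λ s → Q s × R s)
    definable-× (φ , φ⇔Q) (ψ , ψ⇔R) = conj φ ψ , λ s →
      ⇔.trans ∈-conj (mk⇔ (λ (a , b) → to (φ⇔Q s) a , to (ψ⇔R s) b)
                          (λ (q , r) → from (φ⇔Q s) q , from (ψ⇔R s) r))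

    definable-¬ : {Q : St L → Set} → Definable Q → Definable (λ s → ¬ Q s)
    definable-¬ (φ , φ⇔Q) = neg φ , λ s →
      ⇔.trans ∈-neg (mk⇔ (λ s∉φ → s∉φ ∘ from (φ⇔Q s)) (λ ¬Qs → ¬Qs ∘ to (φ⇔Q s)))

    definable-∀ : ∀ {m} {Q : Fin m → St L → Set} → (∀ i → Definable (Q i)) →
                  Definable (λ s → ∀ i → Q i s)
    definable-∀ {zero}      _     = top , λ _ → mk⇔ (λ _ ()) (λ _ → ∈-top)
    definable-∀ {suc m} {Q} Q-def = definable-cong
      (λ s → mk⇔ (λ (q₀ , qs) → λ { zero → q₀ ; (suc i) → qs i }) (λ q → q zero , q ∘ suc))
      (definable-× (Q-def zero) (definable-∀ (Q-def ∘ suc)))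

    definable-⊎ˡ : ∀ {A : Set} {Q : St L → Set} → Dec A → Definable Q → Definable (λ s → A ⊎ Q s)
    definable-⊎ˡ (yes a) _ = top , λ _ → mk⇔ (λ _ → inj₁ a) (λ _ → ∈-top)
    definable-⊎ˡ (no ¬a) = definable-cong λ _ → mk⇔ inj₂ λ { (inj₁ a) → ⊥-elim (¬a a) ; (inj₂ q) → q }

    ¬¬-separable⊎≈ᴸ : ∀ s t → ¬ ¬ (Separable s t ⊎ s ≈ᴸ t)
    ¬¬-separable⊎≈ᴸ s t ¬sep⊎≈ = ¬sep⊎≈ (inj₂ λ φ → mk⇔
      (λ s∈φ → decidable-stable (t ∈? ⟦ φ ⟧) λ t∉φ → ¬sep⊎≈ (inj₁ (φ , s∈φ , t∉φ)))
      (λ t∈φ → decidable-stable (s ∈? ⟦ φ ⟧) λ s∉φ →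
        ¬sep⊎≈ (inj₁ (neg φ , from ∈-neg s∉φ , λ t∈¬φ → to ∈-neg t∈¬φ t∈φ))))

    -- X = ⋂_{t ∉ X} ∁[t], the class [t] being cut out by formulas separating t from each u.
    saturated⇒definable : Saturated X → (∀ s t → Separable s t ⊎ s ≈ᴸ t) → Definable (_∈ X)
    saturated⇒definable {X} X-sat sep = definable-cong (λ s → mk⇔ (out s) (into s))
      (definable-∀ λ t → definable-⊎ˡ (t ∈? X)
        (definable-¬ (definable-∀ λ u → separator t u , λ _ → ⇔.refl)))
      where
        separator : St L → St L → Formula L
        separator t u with sep t u
        ... | inj₁ (φ , _) = φ
        ... | inj₂ _       = top
        ∈-separator : ∀ t u → t ∈ ⟦ separator t u ⟧
        ∈-separator t u with sep t u
        ... | inj₁ (_ , t∈φ , _) = t∈φ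
        ... | inj₂ _             = ∈-top
        ∉-separator : ∀ t u → t ∉ X → u ∈ X → u ∉ ⟦ separator t u ⟧
        ∉-separator t u t∉X u∈X with sep t u
        ... | inj₁ (_ , _ , u∉φ) = u∉φ
        ... | inj₂ t≈u           = λ _ → t∉X (X-sat (≈ᴸ-sym t≈u) u∈X)
        out : ∀ s → (∀ t → t ∈ X ⊎ ¬ (∀ u → s ∈ ⟦ separator t u ⟧)) → s ∈ X
        out s h with h s
        ... | inj₁ s∈X = s∈X
        ... | inj₂ ¬∈  = ⊥-elim (¬∈ (∈-separator s))
        into : ∀ s → s ∈ X → ∀ t → t ∈ X ⊎ ¬ (∀ u → s ∈ ⟦ separator t u ⟧)
        into s s∈X t with t ∈? X
        ... | yes t∈X = inj₁ t∈X
        ... | no  t∉X = inj₂ λ s∈all → ∉-separator t s t∉X s∈X (s∈all s)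

    saturated⇒¬¬definable : Saturated X → ¬ ¬ (∃ λ ψ → ⟦ ψ ⟧ ≡ X)
    saturated⇒¬¬definable X-sat =
      ¬¬-map (λ sep → let ψ , ψ⇔X = saturated⇒definable X-sat sep in ψ , ∈-ext ψ⇔X)
             (¬¬-∀-Fin λ s → ¬¬-∀-Fin (¬¬-separable⊎≈ᴸ s))

    saturated⇒¬¬definables : ∀ {k} {Ss : Vec (Subset size) k} → VAll.All Saturated Ss →
                             ¬ ¬ (∃ λ ψs → ⟦_⟧s L ψs ≡ Ss)
    saturated⇒¬¬definables []               k = k ([] , refl)
    saturated⇒¬¬definables (S-sat ∷ Ss-sat) k =
      saturated⇒¬¬definable S-sat λ (ψ , ⟦ψ⟧≡S) →
      saturated⇒¬¬definables Ss-sat λ (ψs , ⟦ψs⟧≡Ss) → k (ψ ∷ ψs , cong₂ _∷_ ⟦ψ⟧≡S ⟦ψs⟧≡Ss)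

    op-saturated : ∀ f {Ss} → VAll.All Saturated Ss → Saturated (opI f Ss)
    op-saturated f {Ss} Ss-sat {s} {t} s≈t s∈A = decidable-stable (t ∈? opI f Ss) λ t∉A →
      saturated⇒¬¬definables Ss-sat λ (ψs , ⟦ψs⟧≡Ss) →
        t∉A (subst (λ Xs → t ∈ opI f Xs) ⟦ψs⟧≡Ss
               (to (s≈t (app f ψs)) (subst (λ Xs → s ∈ opI f Xs) (sym ⟦ψs⟧≡Ss) s∈A)))

    step-invariant : Invariant P → Step L P P′ → Invariant P′
    step-invariant inv (f , _ , Ss , Ss-pad , _ , refl) = record
      { isPartition      = ⋏-isPartition isPartition split-disjoint split-covers
      ; atoms-closed     = λ p → ⪯-blockClosed ⋏-⪯ˡ (atoms-closed p)
      ; blocks-saturated = ⋏-saturated blocks-saturated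
          (split-saturated (op-saturated f (VAll.map (inPad-saturated blocks-saturated) Ss-pad)))
      }
      where open Invariant inv

    reachable-invariant : Invariant P → Reachable L P P′ → Invariant P′
    reachable-invariant inv ε              = inv
    reachable-invariant inv (step ◅ steps) = reachable-invariant (step-invariant inv step) steps

corollary4p6 : (L : Lang) → ClosedConj L → ClosedNeg L →
    (P₀ : Partition L) → IsPℓ L P₀ →
    AllRunsTerminate L P₀ ×
      (∀ P → Reachable L P₀ P → Final L P → IsPL L P)
corollary4p6 L conj-closed neg-closed P₀ P₀-isPℓ =
  runs-terminate L (Invariant.isPartition inv₀) ,
  λ P P₀↝P P-final →
    final-isPL L P-final (reachable-invariant L conj-closed neg-closed inv₀ P₀↝P)
  where
    inv₀ : Invariant L P₀
    inv₀ = Pℓ-invariant L P₀-isPℓ
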